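{- Define $a(1)=1$ and $a(n)=1+\sum_m a(m)$ for $n>1$, the sum over all proper divisors $m$ of $n$ (positive divisors $m<n$). Let $n$ be a positive integer and let $\tau$ be the maximum exponent in the prime factorization of $n$ (with $\tau=0$ for $n=1$). Then $2^{\tau}$ divides $a(n)$.
   Context: $a(n)$ is called the number of recursive divisors of $n$. -}

module Defs where

open import Data.Nat using (ℕ; zero; suc; _+_; _*_; _^_; _≤_; _<_)
open import Data.Nat.Divisibility using (_∣_; _∣?_)
open import Data.Nat.Primality using (Prime)
open import Data.List using (List; map; filter; upTo)
open import Data.Nat.ListAction using (sum)
open import Data.Product using (Σ; _×_)

properDivisors : ℕ → List ℕ
properDivisors n = filter (λ m → m ∣? n) (Data.List.map suc (upTo (n Data.Nat.∸ 1)))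

-- fuel-bounded recursion; fuel n suffices since proper divisors are < n
aFuel : ℕ → ℕ → ℕ
aFuel zero    n = 1
aFuel (suc f) n = 1 + sum (map (aFuel f) (properDivisors n))

a : ℕ → ℕ
a n = aFuel n n

-- τ is the maximum exponent in the prime factorization of n (n ≥ 1):
-- some prime p has p^τ ∣ n, and no prime power p^k with k > τ divides n.
-- For n = 1 this forces τ = 0.
IsMaxExponent : ℕ → ℕ → Set
IsMaxExponent n τ =
  Σ ℕ (λ p → Prime p × (p ^ τ) ∣ n) ×
  (∀ p k → Prime p → (p ^ k) ∣ n → k ≤ τ)

-- Let p be prime and p^(k+1) ∣ n, so n = N p with p^k ∣ N. The proper divisors of n that
-- divide N are the proper divisors of N together with N itself, so a(n) = 2 a(N) + Σ a(d)
-- over the proper divisors d of n not dividing N. Each such d is divisible by p^(k+1),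
-- so strong induction on n gives 2^(k+1) ∣ a(n).
module Submission where

open import Defs
open import Data.Nat using (ℕ; zero; suc; _+_; _*_; _∸_; _^_; _≤_; _<_; _≤′_; ≤′-refl; ≤′-step; z≤n; s≤s; NonZero; nonTrivial⇒n>1)
open import Data.Nat.Properties using (+-assoc; +-comm; +-identityʳ; *-identityʳ; *-comm; ≤-trans; ≤-refl; <⇒≱; m<m*n; ∸-monoˡ-≤; ≤⇒≤′; ≤′⇒≤; ≤-pred)
open import Data.Nat.Divisibility
open import Data.Nat.Coprimality using (Coprime; coprime-divisor)
open import Data.Nat.Primality using (Prime; prime⇒nonZero; prime⇒nonTrivial; prime⇒irreducible)
open import Data.Nat.Induction using (<-rec)
open import Data.Nat.ListAction using (sum)
open import Data.Nat.ListAction.Properties using (sum-++)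
open import Data.List using (List; []; _∷_; _∷ʳ_; _++_; map; filter; upTo; applyUpTo)
open import Data.List.Properties using (filter-++; filter-accept; filter-reject; ++-identityʳ; map-++; map-upTo; applyUpTo-∷ʳ; map-cong-local)
open import Data.List.Membership.Propositional using (_∈_)
open import Data.List.Membership.Propositional.Properties using (∈-filter⁻; ∈-map⁻; ∈-upTo⁻)
open import Data.List.Relation.Unary.All using (tabulate)
open import Data.List.Relation.Unary.Any using (here; there)
open import Data.Product using (_×_; _,_)
open import Data.Sum using (inj₁; inj₂)
open import Data.Empty using (⊥-elim)
open import Relation.Nullary using (¬_; yes; no)
open import Relation.Unary using (Pred; Decidable; _⊆_)
open import Relation.Unary.Properties using (∁?)
open import Relation.Binary.PropositionalEquality using (_≡_; refl; sym; trans; cong; subst; _≗_; module ≡-Reasoning)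
open import Function using (_∘_)
open import Level using (Level)

private
  variable
    ℓ ℓ′ : Level
    A : Set ℓ

sum-map-∷ʳ : (f : A → ℕ) (xs : List A) (x : A) → sum (map f (xs ∷ʳ x)) ≡ sum (map f xs) + f x
sum-map-∷ʳ f xs x = begin
  sum (map f (xs ++ x ∷ []))           ≡⟨ cong sum (map-++ f xs (x ∷ [])) ⟩
  sum (map f xs ++ f x ∷ [])           ≡⟨ sum-++ (map f xs) (f x ∷ []) ⟩
  sum (map f xs) + (f x + 0)           ≡⟨ cong (sum (map f xs) +_) (+-identityʳ (f x)) ⟩
  sum (map f xs) + f x                 ∎
  where open ≡-Reasoning

sum-map-partition : {P : Pred A ℓ} (P? : Decidable P) (f : A → ℕ) (xs : List A) →
                    sum (map f xs) ≡ sum (map f (filter P? xs)) + sum (map f (filter (∁? P?) xs))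
sum-map-partition P? f [] = refl
sum-map-partition P? f (x ∷ xs) with P? x
... | yes _ = trans (cong (f x +_) (sum-map-partition P? f xs)) (sym (+-assoc (f x) _ _))
... | no _  = begin
  f x + sum (map f xs)   ≡⟨ cong (f x +_) (sum-map-partition P? f xs) ⟩
  f x + (s + t)          ≡⟨ sym (+-assoc (f x) s t) ⟩
  f x + s + t            ≡⟨ cong (_+ t) (+-comm (f x) s) ⟩
  s + f x + t            ≡⟨ +-assoc s (f x) t ⟩
  s + (f x + t)          ∎
  where
  open ≡-Reasoning
  s = sum (map f (filter P? xs))
  t = sum (map f (filter (∁? P?) xs))

∣-sum-map : ∀ {m} (f : A → ℕ) (xs : List A) → (∀ {x} → x ∈ xs → m ∣ f x) → m ∣ sum (map f xs)
∣-sum-map f []       m∣f = _ ∣0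
∣-sum-map f (x ∷ xs) m∣f = ∣m∣n⇒∣m+n (m∣f (here refl)) (∣-sum-map f xs (m∣f ∘ there))

module _ {P : Pred A ℓ} (P? : Decidable P) where

  filter-∷ʳ-accept : ∀ {x} xs → P x → filter P? (xs ∷ʳ x) ≡ filter P? xs ∷ʳ x
  filter-∷ʳ-accept xs Px = trans (filter-++ P? xs _) (cong (filter P? xs ++_) (filter-accept P? Px))

  filter-∷ʳ-reject : ∀ {x} xs → ¬ P x → filter P? (xs ∷ʳ x) ≡ filter P? xs
  filter-∷ʳ-reject xs ¬Px =
    trans (filter-++ P? xs _) (trans (cong (filter P? xs ++_) (filter-reject P? ¬Px)) (++-identityʳ _))

  filter-filter-⊆ : {Q : Pred A ℓ′} (Q? : Decidable Q) → Q ⊆ P → filter Q? ∘ filter P? ≗ filter Q?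
  filter-filter-⊆ Q? Q⊆P [] = refl
  filter-filter-⊆ Q? Q⊆P (x ∷ xs) with P? x
  ... | no ¬Px = trans (filter-filter-⊆ Q? Q⊆P xs) (sym (filter-reject Q? (¬Px ∘ Q⊆P)))
  ... | yes _ with Q? x
  ...   | yes _ = cong (x ∷_) (filter-filter-⊆ Q? Q⊆P xs)
  ...   | no _  = filter-filter-⊆ Q? Q⊆P xs

map-suc-upTo-∷ʳ : ∀ m → map suc (upTo (suc m)) ≡ map suc (upTo m) ∷ʳ suc m
map-suc-upTo-∷ʳ m = begin
  map suc (upTo (suc m))           ≡⟨ map-upTo suc (suc m) ⟩
  applyUpTo suc (suc m)            ≡⟨ sym (applyUpTo-∷ʳ suc m) ⟩
  applyUpTo suc m ∷ʳ suc m         ≡⟨ cong (_∷ʳ suc m) (sym (map-upTo suc m)) ⟩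
  map suc (upTo m) ∷ʳ suc m        ∎
  where open ≡-Reasoning

∈-properDivisors⁻ : ∀ {d n} → d ∈ properDivisors n → 1 ≤ d × d < n × d ∣ n
∈-properDivisors⁻ {d} {n} d∈ with ∈-filter⁻ (_∣? n) {xs = map suc (upTo (n ∸ 1))} d∈
... | d∈range , d∣n with ∈-map⁻ suc d∈range
...   | i , i∈upTo , refl = s≤s z≤n , below n (∈-upTo⁻ i∈upTo) , d∣n
  where
  below : ∀ n → i < n ∸ 1 → suc i < n
  below (suc n) i<n = s≤s i<n

divisors-upTo : ∀ {N m} → 1 ≤ N → N ≤ m → filter (_∣? N) (map suc (upTo m)) ≡ properDivisors N ∷ʳ N
divisors-upTo {suc N} {m} _ N≤m = go (≤⇒≤′ N≤m)
  where
  go : ∀ {m} → suc N ≤′ m → filter (_∣? suc N) (map suc (upTo m)) ≡ properDivisors (suc N) ∷ʳ suc N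
  go ≤′-refl = trans (cong (filter (_∣? suc N)) (map-suc-upTo-∷ʳ N))
                     (filter-∷ʳ-accept (_∣? suc N) (map suc (upTo N)) ∣-refl)
  go (≤′-step {m} N≤′m) = trans (cong (filter (_∣? suc N)) (map-suc-upTo-∷ʳ m))
    (trans (filter-∷ʳ-reject (_∣? suc N) (map suc (upTo m)) (λ m∣N → <⇒≱ (s≤s (≤′⇒≤ N≤′m)) (∣⇒≤ m∣N)))
           (go N≤′m))

aFuel-irrelevant : ∀ f g n → n ≤ f → n ≤ g → aFuel f n ≡ aFuel g n
aFuel-irrelevant zero    zero    n _ _ = refl
aFuel-irrelevant zero    (suc g) zero _ _ = refl
aFuel-irrelevant (suc f) zero    zero _ _ = refl
aFuel-irrelevant (suc f) (suc g) n n≤f n≤g =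
  cong (λ xs → 1 + sum xs) (map-cong-local (tabulate λ d∈ → smaller (∈-properDivisors⁻ d∈)))
  where
  smaller : ∀ {d} → 1 ≤ d × d < n × d ∣ n → aFuel f d ≡ aFuel g d
  smaller (_ , d<n , _) = aFuel-irrelevant f g _ (≤-pred (≤-trans d<n n≤f)) (≤-pred (≤-trans d<n n≤g))

a-unfold : ∀ n → a n ≡ 1 + sum (map a (properDivisors n))
a-unfold zero    = refl
a-unfold (suc n) = cong (λ xs → 1 + sum xs) (map-cong-local (tabulate λ d∈ → smaller (∈-properDivisors⁻ d∈)))
  where
  smaller : ∀ {d} → 1 ≤ d × d < suc n × d ∣ suc n → aFuel n d ≡ a d
  smaller (_ , s≤s d≤n , _) = aFuel-irrelevant n _ _ d≤n ≤-refl

a-split : ∀ {N n} → 1 ≤ N → N < n → N ∣ n →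
          a n ≡ 2 * a N + sum (map a (filter (∁? (_∣? N)) (properDivisors n)))
a-split {N} {n} 1≤N N<n N∣n = begin
  a n                                                ≡⟨ a-unfold n ⟩
  1 + sum (map a (properDivisors n))                 ≡⟨ cong (1 +_) (sum-map-partition (_∣? N) a (properDivisors n)) ⟩
  1 + (sum (map a (filter (_∣? N) (properDivisors n))) + rest)
                                                     ≡⟨ cong (λ xs → 1 + (sum (map a xs) + rest)) divisorsOfN ⟩
  1 + (sum (map a (properDivisors N ∷ʳ N)) + rest)   ≡⟨ cong (λ s → 1 + (s + rest)) (sum-map-∷ʳ a (properDivisors N) N) ⟩
  1 + sum (map a (properDivisors N)) + a N + rest    ≡⟨ cong (λ s → s + a N + rest) (sym (a-unfold N)) ⟩
  a N + a N + rest                                   ≡⟨ cong (λ s → a N + s + rest) (sym (+-identityʳ (a N))) ⟩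
  2 * a N + rest                                     ∎
  where
  open ≡-Reasoning
  rest = sum (map a (filter (∁? (_∣? N)) (properDivisors n)))
  divisorsOfN : filter (_∣? N) (properDivisors n) ≡ properDivisors N ∷ʳ N
  divisorsOfN = trans (filter-filter-⊆ (_∣? n) (_∣? N) (λ d∣N → ∣-trans d∣N N∣n) (map suc (upTo (n ∸ 1))))
                      (divisors-upTo 1≤N (∸-monoˡ-≤ 1 N<n))

module _ {p : ℕ} (p-prime : Prime p) where

  private instance
    p≢0 : NonZero p
    p≢0 = prime⇒nonZero p-prime

  ∣m*p∧∤m⇒p∣ : ∀ {m d} → d ∣ m * p → ¬ d ∣ m → p ∣ d
  ∣m*p∧∤m⇒p∣ {m} {d} d∣mp d∤m with p ∣? d
  ... | yes p∣d = p∣d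
  ... | no  p∤d = ⊥-elim (d∤m (coprime-divisor d⊥p (subst (d ∣_) (*-comm m p) d∣mp)))
    where
    d⊥p : Coprime d p
    d⊥p (i∣d , i∣p) with prime⇒irreducible p-prime i∣p
    ... | inj₁ i≡1 = i≡1
    ... | inj₂ refl = ⊥-elim (p∤d i∣d)

  p^[1+k]∣m*p⇒p^k∣m : ∀ k {m} → p ^ suc k ∣ m * p → p ^ k ∣ m
  p^[1+k]∣m*p⇒p^k∣m k {m} = *-cancelʳ-∣ p ∘ subst (_∣ m * p) (*-comm p (p ^ k))

  ∣m*p∧∤m⇒p^[1+k]∣ : ∀ k {m d} → p ^ k ∣ m → d ∣ m * p → ¬ d ∣ m → p ^ suc k ∣ d
  ∣m*p∧∤m⇒p^[1+k]∣ zero _ d∣mp d∤m = subst (_∣ _) (sym (*-identityʳ p)) (∣m*p∧∤m⇒p∣ d∣mp d∤m)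
  ∣m*p∧∤m⇒p^[1+k]∣ (suc k) p^k∣m d∣mp d∤m
    with ∣m*p∧∤m⇒p∣ d∣mp d∤m | ∣-trans (m∣m*n {p} (p ^ k)) p^k∣m
  ... | divides d′ refl | divides m′ refl =
    subst (_∣ d′ * p) (*-comm (p ^ suc k) p) (*-monoˡ-∣ p (∣m*p∧∤m⇒p^[1+k]∣ k p^k∣m′ d′∣m′p d′∤m′))
    where
    p^k∣m′ : p ^ k ∣ m′
    p^k∣m′ = p^[1+k]∣m*p⇒p^k∣m k p^k∣m
    d′∣m′p : d′ ∣ m′ * p
    d′∣m′p = *-cancelʳ-∣ p d∣mp
    d′∤m′ : ¬ d′ ∣ m′
    d′∤m′ = d∤m ∘ *-monoˡ-∣ p

  p^k∣n⇒2^k∣a[n] : ∀ {n} k → 1 ≤ n → p ^ k ∣ n → 2 ^ k ∣ a n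
  p^k∣n⇒2^k∣a[n] {n} = <-rec (λ n → ∀ k → 1 ≤ n → p ^ k ∣ n → 2 ^ k ∣ a n) step n
    where
    step : ∀ n → (∀ {d} → d < n → ∀ k → 1 ≤ d → p ^ k ∣ d → 2 ^ k ∣ a d) →
           ∀ k → 1 ≤ n → p ^ k ∣ n → 2 ^ k ∣ a n
    step n ih zero    _   _ = 1∣ a n
    step n ih (suc k) 1≤n p^k∣n with ∣-trans (m∣m*n {p} (p ^ k)) p^k∣n
    step _ ih (suc k) ()  _     | divides zero    refl
    step _ ih (suc k) _   p^k∣n | divides (suc N) refl =
      subst (2 ^ suc k ∣_) (sym (a-split (s≤s z≤n) N<n (m∣m*n p))) (∣m∣n⇒∣m+n twice rest)
      where
      N<n : suc N < suc N * p
      N<n = m<m*n (suc N) p (nonTrivial⇒n>1 p {{prime⇒nonTrivial p-prime}})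
      p^k∣N : p ^ k ∣ suc N
      p^k∣N = p^[1+k]∣m*p⇒p^k∣m k p^k∣n
      twice : 2 ^ suc k ∣ 2 * a (suc N)
      twice = *-monoʳ-∣ 2 (ih N<n k (s≤s z≤n) p^k∣N)
      rest : 2 ^ suc k ∣ sum (map a (filter (∁? (_∣? suc N)) (properDivisors (suc N * p))))
      rest = ∣-sum-map a (filter (∁? (_∣? suc N)) (properDivisors (suc N * p)))
                       (newDivisor ∘ ∈-filter⁻ (∁? (_∣? suc N)))
        where
        newDivisor : ∀ {d} → d ∈ properDivisors (suc N * p) × ¬ d ∣ suc N → 2 ^ suc k ∣ a d
        newDivisor (d∈ , d∤N) with ∈-properDivisors⁻ d∈
        ... | 1≤d , d<n , d∣n = ih d<n (suc k) 1≤d (∣m*p∧∤m⇒p^[1+k]∣ k p^k∣N d∣n d∤N)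

corollary1 : (n τ : ℕ) → 1 ≤ n → IsMaxExponent n τ → (2 ^ τ) ∣ a n
corollary1 n τ 1≤n ((p , p-prime , p^τ∣n) , _) = p^k∣n⇒2^k∣a[n] p-prime τ 1≤n p^τ∣n
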